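{- Let $\sigma$ be a real number with $\frac{1}{120} < \sigma \le \frac{1}{102}$. Let $0 < g \le \frac16 - 2\sigma$ and $\frac13 - 4\sigma < \gamma < \frac23 - 8\sigma$. Let $\rho_1 \ge \rho_2 \ge \cdots \ge \rho_t \ge 0$ be real numbers with $\rho_1 + \cdots + \rho_t = \gamma$ and $\rho_1 \le \gamma - g$. Then there is a set $\mathcal{C} \subset \{1,\ldots,t\}$ with \[ \sum_{i \in \mathcal{C}} \rho_i \in \left[g, \tfrac13 - 4\sigma\right]. \] -}

module Defs where

open import Level using (Level; suc; _⊔_)
open import Data.Nat using (ℕ; zero) renaming (suc to sucℕ)
open import Data.Fin using (Fin) renaming (zero to fzero; suc to fsuc)
open import Data.Bool using (Bool; true; false; if_then_else_)
open import Data.Product using (∃)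
open import Data.Sum using (_⊎_)
open import Relation.Nullary using (¬_)
open import Relation.Binary.PropositionalEquality using (_≡_)
open import Relation.Binary using (Rel; IsStrictTotalOrder)
open import Algebra.Structures using (IsCommutativeRing)

record OrderedField (c ℓ : Level) : Set (suc (c ⊔ ℓ)) where
  infixl 6 _+_ _-_
  infixl 7 _*_
  infix 4 _<_ _≤_
  field
    Carrier : Set c
    _+_ _*_ : Carrier → Carrier → Carrier
    -_      : Carrier → Carrier
    0# 1#   : Carrier
    _<_     : Rel Carrier ℓ
    isCommutativeRing : IsCommutativeRing _≡_ _+_ _*_ -_ 0# 1#
    isStrictTotalOrder : IsStrictTotalOrder _≡_ _<_
    0<1     : 0# < 1#
    +-mono-< : ∀ {x y} z → x < y → x + z < y + z
    *-pos    : ∀ {x y} → 0# < x → 0# < y → 0# < x * y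
    inverse  : ∀ x → ¬ (x ≡ 0#) → ∃ λ y → x * y ≡ 1#

  _≤_ : Carrier → Carrier → Set (c ⊔ ℓ)
  x ≤ y = (x < y) ⊎ (x ≡ y)

  _-_ : Carrier → Carrier → Carrier
  x - y = x + (- y)

  fromℕ : ℕ → Carrier
  fromℕ zero = 0#
  fromℕ (sucℕ n) = 1# + fromℕ n

  sumFin : ∀ n → (Fin n → Carrier) → Carrier
  sumFin zero f = 0#
  sumFin (sucℕ n) f = f fzero + sumFin n (λ i → f (fsuc i))

  -- sum_{i ∈ C} f i, for a subset C of Fin n given by its indicator function
  sumSub : ∀ n → (Fin n → Bool) → (Fin n → Carrier) → Carrier
  sumSub n C f = sumFin n (λ i → if C i then f i else 0#)

{-# OPTIONS --safe #-}
-- Write M = 1 - 12σ, three times the upper end of the window. If the largest part ρ₁ is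
-- below g, add parts one by one until the sum first reaches g: it then overshoots g by
-- less than ρ₁ < g, so it stays below 2g ≤ M/3. Otherwise ρ₁ ≥ g, and either ρ₁ alone
-- lies in the window, or 3ρ₁ > M and the remaining parts, whose sum γ - ρ₁ is at least g
-- because ρ₁ ≤ γ - g, satisfy 3(γ - ρ₁) < 2M - M = M.
module Submission where

open import Defs
open import Data.Nat using (ℕ; suc; z≤n)
import Data.Nat as ℕ
open import Data.Fin using (Fin) renaming (zero to fzero; suc to fsuc; _≤_ to _≤ᶠ_)
open import Data.Bool using (Bool; true; false)
open import Data.Product using (∃; _×_; _,_)
open import Data.Sum using (_⊎_; inj₁; inj₂)
open import Data.Vec.Functional using (_∷_; replicate)
open import Data.Empty using (⊥-elim)
open import Relation.Nullary using (¬_)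
open import Relation.Binary.PropositionalEquality
open import Relation.Binary.Definitions using (tri<; tri≈; tri>)
open import Relation.Binary.Structures using (IsStrictTotalOrder)
open import Algebra.Bundles using (CommutativeRing)
open import Algebra.Structures using (IsCommutativeRing)
import Algebra.Properties.AbelianGroup as AbelianGroupProperties
import Algebra.Properties.CommutativeSemigroup as CommutativeSemigroupProperties

module OrderedFieldProperties {c ℓ} (F : OrderedField c ℓ) where
  open OrderedField F
  open IsCommutativeRing isCommutativeRing
    using (+-assoc; +-comm; +-identityˡ; +-identityʳ; *-identityˡ; distribˡ; distribʳ; zeroˡ)
  open IsStrictTotalOrder isStrictTotalOrder using (compare; irrefl) renaming (trans to <-trans)

  private
    commutativeRing : CommutativeRing c c
    commutativeRing = record { isCommutativeRing = isCommutativeRing }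
    open CommutativeRing commutativeRing using (+-abelianGroup; +-commutativeSemigroup)
    open AbelianGroupProperties +-abelianGroup using (⁻¹-∙-comm; \\-leftDividesʳ; //-rightDividesˡ; ∙-cancelˡ)
    open CommutativeSemigroupProperties +-commutativeSemigroup using (interchange)

  <-or-≥ : ∀ x y → x < y ⊎ y ≤ x
  <-or-≥ x y with compare x y
  ... | tri< x<y _ _ = inj₁ x<y
  ... | tri≈ _ x≡y _ = inj₂ (inj₂ (sym x≡y))
  ... | tri> _ _ y<x = inj₂ (inj₁ y<x)

  ≤-trans : ∀ {x y z} → x ≤ y → y ≤ z → x ≤ z
  ≤-trans (inj₁ x<y) (inj₁ y<z) = inj₁ (<-trans x<y y<z)
  ≤-trans (inj₁ x<y) (inj₂ refl) = inj₁ x<y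
  ≤-trans (inj₂ refl) y≤z = y≤z

  <-≤-trans : ∀ {x y z} → x < y → y ≤ z → x < z
  <-≤-trans x<y (inj₁ y<z) = <-trans x<y y<z
  <-≤-trans x<y (inj₂ refl) = x<y

  <⇒≱ : ∀ {x y} → x < y → ¬ (y ≤ x)
  <⇒≱ x<y y≤x = irrefl refl (<-≤-trans x<y y≤x)

  +-monoʳ-< : ∀ {x y} z → x < y → z + x < z + y
  +-monoʳ-< {x} {y} z x<y = subst₂ _<_ (+-comm x z) (+-comm y z) (+-mono-< z x<y)

  +-monoʳ-≤ : ∀ {x y} z → x ≤ y → z + x ≤ z + y
  +-monoʳ-≤ z (inj₁ x<y) = inj₁ (+-monoʳ-< z x<y)
  +-monoʳ-≤ z (inj₂ refl) = inj₂ refl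

  +-monoˡ-≤ : ∀ {x y} z → x ≤ y → x + z ≤ y + z
  +-monoˡ-≤ z (inj₁ x<y) = inj₁ (+-mono-< z x<y)
  +-monoˡ-≤ z (inj₂ refl) = inj₂ refl

  +-mono-<-≤ : ∀ {x y u v} → x < y → u ≤ v → x + u < y + v
  +-mono-<-≤ {y = y} {u = u} x<y u≤v = <-≤-trans (+-mono-< u x<y) (+-monoʳ-≤ y u≤v)

  +-mono-≤ : ∀ {x y u v} → x ≤ y → u ≤ v → x + u ≤ y + v
  +-mono-≤ {y = y} {u = u} x≤y u≤v = ≤-trans (+-monoˡ-≤ u x≤y) (+-monoʳ-≤ y u≤v)

  +-cancelˡ-< : ∀ {x y} z → z + x < z + y → x < y
  +-cancelˡ-< {x} {y} z z+x<z+y =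
    subst₂ _<_ (\\-leftDividesʳ z x) (\\-leftDividesʳ z y) (+-monoʳ-< (- z) z+x<z+y)

  +-cancelˡ-≤ : ∀ {x y} z → z + x ≤ z + y → x ≤ y
  +-cancelˡ-≤ z (inj₁ z+x<z+y) = inj₁ (+-cancelˡ-< z z+x<z+y)
  +-cancelˡ-≤ z (inj₂ z+x≡z+y) = inj₂ (∙-cancelˡ z _ _ z+x≡z+y)

  x≤y-z⇒x+z≤y : ∀ {x y z} → x ≤ y - z → x + z ≤ y
  x≤y-z⇒x+z≤y {x} {y} {z} x≤y-z = subst (x + z ≤_) (//-rightDividesˡ z y) (+-monoˡ-≤ z x≤y-z)

  fromℕ-+ : ∀ m n → fromℕ (m ℕ.+ n) ≡ fromℕ m + fromℕ n
  fromℕ-+ 0 n = sym (+-identityˡ (fromℕ n))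
  fromℕ-+ (suc m) n = trans (cong (1# +_) (fromℕ-+ m n)) (sym (+-assoc 1# (fromℕ m) (fromℕ n)))

  fromℕ-+-* : ∀ m n x → fromℕ (m ℕ.+ n) * x ≡ fromℕ m * x + fromℕ n * x
  fromℕ-+-* m n x = trans (cong (_* x) (fromℕ-+ m n)) (distribʳ x (fromℕ m) (fromℕ n))

  fromℕ-suc-* : ∀ n x → fromℕ (suc n) * x ≡ x + fromℕ n * x
  fromℕ-suc-* n x = trans (distribʳ x 1# (fromℕ n)) (cong (_+ fromℕ n * x) (*-identityˡ x))

  fromℕ-*-double : ∀ n x → fromℕ n * (x + x) ≡ fromℕ (n ℕ.+ n) * x
  fromℕ-*-double n x = trans (distribˡ (fromℕ n) x x) (sym (fromℕ-+-* n n x))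

  two-minus-double : ∀ n x → fromℕ 2 - fromℕ (n ℕ.+ n) * x ≡ (1# - fromℕ n * x) + (1# - fromℕ n * x)
  two-minus-double n x = begin
    fromℕ 2 - fromℕ (n ℕ.+ n) * x  ≡⟨ cong₂ _-_ (cong (1# +_) (+-identityʳ 1#)) (fromℕ-+-* n n x) ⟩
    (1# + 1#) - (a + a)            ≡⟨ cong ((1# + 1#) +_) (⁻¹-∙-comm a a) ⟨
    (1# + 1#) + (- a + - a)        ≡⟨ interchange 1# 1# (- a) (- a) ⟩
    (1# - a) + (1# - a)            ∎
    where
    open ≡-Reasoning
    a = fromℕ n * x

  fromℕ-*-monoʳ-≤ : ∀ n {x y} → x ≤ y → fromℕ n * x ≤ fromℕ n * y
  fromℕ-*-monoʳ-≤ 0 {x} {y} _ = inj₂ (trans (zeroˡ x) (sym (zeroˡ y)))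
  fromℕ-*-monoʳ-≤ (suc n) {x} {y} x≤y =
    subst₂ _≤_ (sym (fromℕ-suc-* n x)) (sym (fromℕ-suc-* n y)) (+-mono-≤ x≤y (fromℕ-*-monoʳ-≤ n x≤y))

  fromℕ-suc-*-monoʳ-< : ∀ n {x y} → x < y → fromℕ (suc n) * x < fromℕ (suc n) * y
  fromℕ-suc-*-monoʳ-< n {x} {y} x<y =
    subst₂ _<_ (sym (fromℕ-suc-* n x)) (sym (fromℕ-suc-* n y)) (+-mono-<-≤ x<y (fromℕ-*-monoʳ-≤ n (inj₁ x<y)))

  sumFin-zero : ∀ n → sumFin n (λ _ → 0#) ≡ 0#
  sumFin-zero 0 = refl
  sumFin-zero (suc n) = trans (cong (0# +_) (sumFin-zero n)) (+-identityˡ 0#)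

  sumSub-head : ∀ n (f : Fin (suc n) → Carrier) → sumSub (suc n) (true ∷ replicate n false) f ≡ f fzero
  sumSub-head n f = trans (cong (f fzero +_) (sumFin-zero n)) (+-identityʳ (f fzero))

  sumSub-tail : ∀ n (f : Fin (suc n) → Carrier) →
                sumSub (suc n) (false ∷ replicate n true) f ≡ sumFin n (λ i → f (fsuc i))
  sumSub-tail n f = +-identityˡ _

  greedy-subsum : ∀ m (f : Fin m → Carrier) {a b g} → (∀ i → f i ≤ b) → a < g → g ≤ a + sumFin m f →
                  ∃ λ C → (g ≤ a + sumSub m C f) × (a + sumSub m C f < g + b)
  greedy-subsum 0 f {a} _ a<g g≤a+0 = ⊥-elim (<⇒≱ a<g (subst (_ ≤_) (+-identityʳ a) g≤a+0))
  greedy-subsum (suc m) f {a} {b} {g} f≤b a<g g≤a+Σf with <-or-≥ (a + f fzero) g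
  ... | inj₂ g≤a+f₀ =
    true ∷ replicate m false , subst (g ≤_) a+f₀≡s g≤a+f₀ , subst (_< g + b) a+f₀≡s (+-mono-<-≤ a<g (f≤b fzero))
    where a+f₀≡s = cong (a +_) (sym (sumSub-head m f))
  ... | inj₁ a+f₀<g
      with greedy-subsum m (λ i → f (fsuc i)) (λ i → f≤b (fsuc i)) a+f₀<g
             (subst (g ≤_) (sym (+-assoc a (f fzero) _)) g≤a+Σf)
  ...    | C , g≤s , s<g+b = true ∷ C , subst (g ≤_) reassoc g≤s , subst (_< g + b) reassoc s<g+b
           where reassoc = +-assoc a (f fzero) _

  subsum-of-small-parts : ∀ m (f : Fin m → Carrier) {b g M} →
    (∀ i → f i ≤ b) → b < g → 0# < g → g ≤ sumFin m f → fromℕ 6 * g ≤ M →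
    ∃ λ C → (g ≤ sumSub m C f) × (fromℕ 3 * sumSub m C f ≤ M)
  subsum-of-small-parts m f {b} {g} f≤b b<g 0<g g≤Σf 6g≤M
    with greedy-subsum m f f≤b 0<g (subst (g ≤_) (sym (+-identityˡ _)) g≤Σf)
  ... | C , g≤s , s<g+b = C , subst (g ≤_) (+-identityˡ _) g≤s , inj₁ (<-≤-trans 3s<6g 6g≤M)
    where
    s<g+g : sumSub m C f < g + g
    s<g+g = <-trans (subst (_< g + b) (+-identityˡ _) s<g+b) (+-monoʳ-< g b<g)
    3s<6g : fromℕ 3 * sumSub m C f < fromℕ 6 * g
    3s<6g = subst (fromℕ 3 * sumSub m C f <_) (fromℕ-*-double 3 g) (fromℕ-suc-*-monoʳ-< 2 s<g+g)

  subsum-with-large-head : ∀ n (f : Fin (suc n) → Carrier) {g M} →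
    g ≤ f fzero → f fzero ≤ sumFin (suc n) f - g → fromℕ 3 * sumFin (suc n) f < M + M →
    ∃ λ C → (g ≤ sumSub (suc n) C f) × (fromℕ 3 * sumSub (suc n) C f ≤ M)
  subsum-with-large-head n f {g} {M} g≤f₀ f₀≤Σf-g 3Σf<M+M with <-or-≥ M (fromℕ 3 * f fzero)
  ... | inj₂ 3f₀≤M =
    true ∷ replicate n false , subst (g ≤_) (sym (sumSub-head n f)) g≤f₀ ,
    subst (λ s → fromℕ 3 * s ≤ M) (sym (sumSub-head n f)) 3f₀≤M
  ... | inj₁ M<3f₀ =
    false ∷ replicate n true , subst (g ≤_) (sym (sumSub-tail n f)) g≤T ,
    subst (λ s → fromℕ 3 * s ≤ M) (sym (sumSub-tail n f)) (inj₁ 3T<M)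
    where
    T = sumFin n (λ i → f (fsuc i))
    g≤T : g ≤ T
    g≤T = +-cancelˡ-≤ (f fzero) (x≤y-z⇒x+z≤y f₀≤Σf-g)
    3T<M : fromℕ 3 * T < M
    3T<M = +-cancelˡ-< M (<-trans (+-mono-< (fromℕ 3 * T) M<3f₀)
                                    (subst (_< M + M) (distribˡ (fromℕ 3) (f fzero) T) 3Σf<M+M))

  subsum-in-window : ∀ n (f : Fin (suc n) → Carrier) {g M} →
    (∀ i → f i ≤ f fzero) → 0# ≤ f fzero → 0# < g → fromℕ 6 * g ≤ M →
    f fzero ≤ sumFin (suc n) f - g → fromℕ 3 * sumFin (suc n) f < M + M →
    ∃ λ C → (g ≤ sumSub (suc n) C f) × (fromℕ 3 * sumSub (suc n) C f ≤ M)
  subsum-in-window n f {g} f≤f₀ 0≤f₀ 0<g 6g≤M f₀≤Σf-g 3Σf<M+M with <-or-≥ (f fzero) g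
  ... | inj₁ f₀<g = subsum-of-small-parts (suc n) f f≤f₀ f₀<g 0<g g≤Σf 6g≤M
    where
    g≤Σf : g ≤ sumFin (suc n) f
    g≤Σf = subst (_≤ _) (+-identityˡ g) (x≤y-z⇒x+z≤y (≤-trans 0≤f₀ f₀≤Σf-g))
  ... | inj₂ g≤f₀ = subsum-with-large-head n f g≤f₀ f₀≤Σf-g 3Σf<M+M

lemma8 : ∀ {c ℓ} (F : OrderedField c ℓ) → let open OrderedField F in
    (σ g γ : Carrier) (n : ℕ) (ρ : Fin (suc n) → Carrier) →
    1# < fromℕ 120 * σ → fromℕ 102 * σ ≤ 1# →
    0# < g → fromℕ 6 * g ≤ 1# - fromℕ 12 * σ →
    1# - fromℕ 12 * σ < fromℕ 3 * γ → fromℕ 3 * γ < fromℕ 2 - fromℕ 24 * σ →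
    (∀ (i j : Fin (suc n)) → i ≤ᶠ j → ρ j ≤ ρ i) →
    (∀ i → 0# ≤ ρ i) →
    sumFin (suc n) ρ ≡ γ →
    ρ fzero ≤ γ - g →
    ∃ λ (C : Fin (suc n) → Bool) →
      (g ≤ sumSub (suc n) C ρ) × (fromℕ 3 * sumSub (suc n) C ρ ≤ 1# - fromℕ 12 * σ)
lemma8 F σ g _ n ρ _ _ 0<g 6g≤M _ 3γ<2-24σ antitone nonneg refl ρ₀≤γ-g =
  subsum-in-window n ρ (λ i → antitone fzero i z≤n) (nonneg fzero) 0<g 6g≤M ρ₀≤γ-g
    (subst (fromℕ 3 * sumFin (suc n) ρ <_) (two-minus-double 12 σ) 3γ<2-24σ)
  where open OrderedField F; open OrderedFieldProperties F
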